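{- For every positive integer $n$, stit logic has the Restricted $n$-Robinson Consistency Property $(RRCP)_n$ if and only if it has the Restricted $n$-Craig Interpolation Property $(RCIP)_n$. Here $(RRCP)_n$ means: for every set of propositional variables $V$ and all $\Gamma, \Delta \subseteq \mathcal{L}^{\{1,\ldots,n\}}_V$, if the pair $(\Gamma,\Delta)$ is inseparable then $\Gamma \cup \Delta$ is consistent; and $(RCIP)_n$ means: for every set of propositional variables $V$ and all $A,B \in \mathcal{L}^{\{1,\ldots,n\}}_V$ with $\vdash A \to B$ and $Ag(A)\cap Ag(B) = \emptyset$, there exists $C \in \mathcal{L}^{Ag(A)\cup Ag(B)}_{|A|\cap|B|}$ with $\vdash A \to C$ and $\vdash C \to B$.
   Context: For a finite set $Ag$ of agent indices and a set $V$ of propositional variables, $\mathcal{L}^{Ag}_V$ is the set of stit formulas given by $A ::= p \mid A \to A \mid \bot \mid \Box A \mid [j]A$ with $p \in V$, $j \in Ag$ (other Boolean connectives defined as usual; $\Diamond A := \neg\Box\neg A$). $\vdash A$ means derivability in the axiom system $\mathbb{S}$ with axioms: all classical propositional tautologies; S5 axioms for $\Box$ and for each $[j]$; $\Box A \to [j]A$; and $(\Diamond[j_1]A_1 \wedge\dots\wedge \Diamond[j_k]A_k) \to \Diamond([j_1]A_1\wedge\dots\wedge[j_k]A_k)$ for pairwise distinct $j_1,\dots,j_k$; rules: modus ponens and necessitation for $\Box$. For a set $\Gamma$ of formulas, $\Gamma \vdash A$ means $\vdash (A_1\wedge\dots\wedge A_r)\to A$ for some $A_1,\dots,A_r \in \Gamma$;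 $\Gamma$ is consistent iff not $\Gamma\vdash\bot$. $|\Gamma|$ denotes the set of propositional variables occurring in formulas of $\Gamma$ and $Ag(\Gamma)$ the set of agent indices occurring in $\Gamma$ (for a single formula $A$, $|A| = |\{A\}|$, $Ag(A) = Ag(\{A\})$). A pair $(\Gamma,\Delta)$ of sets of formulas is inseparable iff $Ag(\Gamma)\cap Ag(\Delta) = \emptyset$ and there is no $C \in \mathcal{L}^{Ag(\Gamma)\cup Ag(\Delta)}_{|\Gamma|\cap|\Delta|}$ such that both $\Gamma \vdash C$ and $\Delta \vdash \neg C$. -}

module Defs where

open import Level using (0ℓ)
open import Data.Nat using (ℕ)
open import Data.Fin using (Fin)
open import Data.Bool using (Bool; true; false; not; _∨_)
open import Data.List using (List; []; _∷_; map)
open import Data.List.Relation.Unary.All using (All)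
open import Data.List.Relation.Unary.Unique.Propositional using (Unique)
open import Data.Product using (Σ; _×_; _,_; proj₁; proj₂; ∃)
open import Data.Sum using (_⊎_)
open import Data.Empty using (⊥)
open import Relation.Nullary using (¬_)
open import Relation.Binary.PropositionalEquality using (_≡_)

data Form (n : ℕ) (V : Set) : Set where
  var  : V → Form n V
  _⇒_  : Form n V → Form n V → Form n V
  falsum : Form n V
  □_   : Form n V → Form n V
  [_]_ : Fin n → Form n V → Form n V

infixr 5 _⇒_
infix 7 □_ [_]_

module _ {n : ℕ} {V : Set} where

  ¬'_ : Form n V → Form n V
  ¬' A = A ⇒ falsum

  ⊤' : Form n V
  ⊤' = falsum ⇒ falsum

  _∧'_ : Form n V → Form n V → Form n V
  A ∧' B = ¬' (A ⇒ ¬' B)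

  ◇_ : Form n V → Form n V
  ◇ A = ¬' (□ (¬' A))

  infix 8 ¬'_
  infixr 6 _∧'_
  infix 7 ◇_

  ⋀ : List (Form n V) → Form n V
  ⋀ []       = ⊤'
  ⋀ (A ∷ As) = A ∧' ⋀ As

  -- Classical propositional tautologies: formulas true under every Boolean
  -- valuation that assigns arbitrary values to the non-Boolean
  -- subformulas (variables, □B, [j]B).
  evalB : (Form n V → Bool) → Form n V → Bool
  evalB v (var p)   = v (var p)
  evalB v (A ⇒ B)   = not (evalB v A) ∨ evalB v B
  evalB v falsum    = false
  evalB v (□ A)     = v (□ A)
  evalB v ([ j ] A) = v ([ j ] A)

  Tautology : Form n V → Set
  Tautology A = (v : Form n V → Bool) → evalB v A ≡ true

  indepAx : List (Fin n × Form n V) → Form n V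
  indepAx js = ⋀ (map (λ jA → ◇ ([ proj₁ jA ] proj₂ jA)) js)
             ⇒ ◇ (⋀ (map (λ jA → [ proj₁ jA ] proj₂ jA) js))

  data ⊢_ : Form n V → Set where
    taut   : ∀ {A} → Tautology A → ⊢ A
    □K     : ∀ {A B} → ⊢ □ (A ⇒ B) ⇒ □ A ⇒ □ B
    □T     : ∀ {A} → ⊢ □ A ⇒ A
    □5     : ∀ {A} → ⊢ ◇ A ⇒ □ ◇ A
    stitK  : ∀ {j A B} → ⊢ [ j ] (A ⇒ B) ⇒ [ j ] A ⇒ [ j ] B
    stitT  : ∀ {j A} → ⊢ [ j ] A ⇒ A
    stit5  : ∀ {j A} → ⊢ ¬' ([ j ] (¬' A)) ⇒ [ j ] (¬' ([ j ] (¬' A)))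
    □stit  : ∀ {j A} → ⊢ □ A ⇒ [ j ] A
    indep  : (js : List (Fin n × Form n V)) → Unique (map proj₁ js) → ⊢ indepAx js
    mp     : ∀ {A B} → ⊢ A ⇒ B → ⊢ A → ⊢ B
    nec    : ∀ {A} → ⊢ A → ⊢ □ A

  infix 3 ⊢_

  FSet : Set₁
  FSet = Form n V → Set

  _∪_ : FSet → FSet → FSet
  (Γ ∪ Δ) A = Γ A ⊎ Δ A

  infix 3 _⊩_
  _⊩_ : FSet → Form n V → Set
  Γ ⊩ A = Σ (List (Form n V)) λ As → All Γ As × (⊢ ⋀ As ⇒ A)

  Consistent : FSet → Set
  Consistent Γ = ¬ (Γ ⊩ falsum)

  data VarIn (p : V) : Form n V → Set where
    here  : VarIn p (var p)
    impl  : ∀ {A B} → VarIn p A → VarIn p (A ⇒ B)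
    impr  : ∀ {A B} → VarIn p B → VarIn p (A ⇒ B)
    box   : ∀ {A} → VarIn p A → VarIn p (□ A)
    stit  : ∀ {j A} → VarIn p A → VarIn p ([ j ] A)

  data AgIn (i : Fin n) : Form n V → Set where
    here  : ∀ {A} → AgIn i ([ i ] A)
    impl  : ∀ {A B} → AgIn i A → AgIn i (A ⇒ B)
    impr  : ∀ {A B} → AgIn i B → AgIn i (A ⇒ B)
    box   : ∀ {A} → AgIn i A → AgIn i (□ A)
    stit  : ∀ {j A} → AgIn i A → AgIn i ([ j ] A)

  VarsOf : FSet → V → Set
  VarsOf Γ p = ∃ λ A → Γ A × VarIn p A

  AgsOf : FSet → Fin n → Set
  AgsOf Γ i = ∃ λ A → Γ A × AgIn i A

  InLang : (Fin n → Set) → (V → Set) → Form n V → Set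
  InLang Ags Vars C = (∀ p → VarIn p C → Vars p) × (∀ i → AgIn i C → Ags i)

  Inseparable : FSet → FSet → Set
  Inseparable Γ Δ =
    (∀ i → ¬ (AgsOf Γ i × AgsOf Δ i)) ×
    ¬ (Σ (Form n V) λ C →
         InLang (λ i → AgsOf Γ i ⊎ AgsOf Δ i)
                (λ p → VarsOf Γ p × VarsOf Δ p) C ×
         (Γ ⊩ C) × (Δ ⊩ (¬' C)))

RRCP : ℕ → Set₁
RRCP n = (V : Set) (Γ Δ : FSet {n} {V}) → Inseparable Γ Δ → Consistent (Γ ∪ Δ)

RCIP : ℕ → Set₁
RCIP n = (V : Set) (A B : Form n V) →
  (⊢ A ⇒ B) →
  (∀ i → ¬ (AgIn i A × AgIn i B)) →
  Σ (Form n V) λ C →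
    InLang (λ i → AgIn i A ⊎ AgIn i B) (λ p → VarIn p A × VarIn p B) C ×
    (⊢ A ⇒ C) × (⊢ C ⇒ B)

-- If Γ ∪ Δ is inconsistent, some finite G ⊆ Γ and D ⊆ Δ satisfy ⊢ ⋀G → ¬⋀D.
-- Disjointness of agents lets (RCIP)ₙ interpolate a C between them, and then
-- Γ ⊢ C and Δ ⊢ ¬C separate (Γ, Δ).  Conversely, if ⊢ A → B then {A} ∪ {¬B}
-- is inconsistent, so by (RRCP)ₙ the pair ({A}, {¬B}) is separated by some C,
-- which is an interpolant of A and B; producing C from the mere impossibility
-- of its absence is where excluded middle enters.
module Submission where

open import Defs
open import Level using (0ℓ)
open import Data.Nat using (ℕ; zero; suc; _≤_)
open import Data.Fin using (Fin; zero; suc)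
open import Data.Bool using (Bool; true; false; not; _∨_; T)
open import Data.Bool.Properties using (T-≡)
open import Data.Vec using (Vec; []; _∷_; lookup)
import Data.Vec as Vec
open import Data.Vec.Properties using (lookup-map)
open import Data.List using (List; []; _∷_)
open import Data.List.Relation.Unary.All using (All; []; _∷_; lookupAny)
import Data.List.Relation.Unary.All as All
open import Data.List.Relation.Unary.Any using (Any; here; there)
import Data.List.Relation.Unary.Any as Any
open import Data.Product using (∃₂; _×_; _,_)
open import Data.Sum using (inj₁; inj₂)
import Data.Sum as Sum
open import Function using (_∘_; Equivalence)
open import Relation.Nullary using (¬_)
open import Relation.Binary.PropositionalEquality using (_≡_; refl; sym; trans; cong₂)
open import Axiom.ExcludedMiddle using (ExcludedMiddle)
open import Axiom.DoubleNegationElimination using (em⇒dne)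

data Schema (k : ℕ) : Set where
  #_  : Fin k → Schema k
  _⇛_ : Schema k → Schema k → Schema k
  ⊥ˢ  : Schema k

infixr 5 _⇛_
infix 8 #_

pattern P = # zero
pattern Q = # suc zero
pattern R = # suc (suc zero)
pattern S = # suc (suc (suc zero))

module _ {k : ℕ} where

  ¬ˢ_ : Schema k → Schema k
  ¬ˢ s = s ⇛ ⊥ˢ

  ⊤ˢ : Schema k
  ⊤ˢ = ⊥ˢ ⇛ ⊥ˢ

  infix 8 ¬ˢ_
  infixr 6 _∧ˢ_

  _∧ˢ_ : Schema k → Schema k → Schema k
  s ∧ˢ t = ¬ˢ (s ⇛ ¬ˢ t)

  truth : Vec Bool k → Schema k → Bool
  truth ρ (# i)   = lookup ρ i
  truth ρ (s ⇛ t) = not (truth ρ s) ∨ truth ρ t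
  truth ρ ⊥ˢ      = false

AllRows : (k : ℕ) → (Vec Bool k → Bool) → Set
AllRows zero    f = T (f [])
AllRows (suc k) f = AllRows k (f ∘ (true ∷_)) × AllRows k (f ∘ (false ∷_))

allRows : ∀ {k} (f : Vec Bool k → Bool) → AllRows k f → ∀ ρ → f ρ ≡ true
allRows f h       []          = Equivalence.to (T-≡ {f []}) h
allRows f (h , _) (true ∷ ρ)  = allRows (f ∘ (true ∷_)) h ρ
allRows f (_ , h) (false ∷ ρ) = allRows (f ∘ (false ∷_)) h ρ

module _ {n : ℕ} {V : Set} where

  ⟦_⟧ : ∀ {k} → Schema k → Vec (Form n V) k → Form n V
  ⟦ # i ⟧   σ = lookup σ i
  ⟦ s ⇛ t ⟧ σ = ⟦ s ⟧ σ ⇒ ⟦ t ⟧ σ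
  ⟦ ⊥ˢ ⟧    σ = falsum

  evalB-⟦⟧ : ∀ {k} v (s : Schema k) (σ : Vec (Form n V) k) →
             evalB v (⟦ s ⟧ σ) ≡ truth (Vec.map (evalB v) σ) s
  evalB-⟦⟧ v (# i)   σ = sym (lookup-map i (evalB v) σ)
  evalB-⟦⟧ v (s ⇛ t) σ = cong₂ (λ a b → not a ∨ b) (evalB-⟦⟧ v s σ) (evalB-⟦⟧ v t σ)
  evalB-⟦⟧ v ⊥ˢ      σ = refl

  -- For a concrete valid schema AllRows reduces to a product of ⊤'s, so the
  -- truth-table check `valid` is found by eta and need never be written.
  tautology : ∀ {k} (s : Schema k) {valid : AllRows k (λ ρ → truth ρ s)} →
              (σ : Vec (Form n V) k) → ⊢ ⟦ s ⟧ σ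
  tautology s {valid} σ = taut λ v →
    trans (evalB-⟦⟧ v s σ) (allRows (λ ρ → truth ρ s) valid (Vec.map (evalB v) σ))

  private variable
    A B C : Form n V
    As : List (Form n V)
    p : V
    i : Fin n

  mp₂ : ⊢ A ⇒ B ⇒ C → ⊢ A → ⊢ B → ⊢ C
  mp₂ ⊢A⇒B⇒C ⊢A ⊢B = mp (mp ⊢A⇒B⇒C ⊢A) ⊢B

  ⇒-refl : ⊢ A ⇒ A
  ⇒-refl {A} = tautology (P ⇛ P) (A ∷ [])

  ⇒-trans : ⊢ A ⇒ B → ⊢ B ⇒ C → ⊢ A ⇒ C
  ⇒-trans {A} {B} {C} = mp₂ (tautology ((P ⇛ Q) ⇛ (Q ⇛ R) ⇛ (P ⇛ R)) (A ∷ B ∷ C ∷ []))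

  ⇒-contraposeˡ : ⊢ ¬' A ⇒ ¬' B → ⊢ B ⇒ A
  ⇒-contraposeˡ {A} {B} = mp (tautology ((¬ˢ P ⇛ ¬ˢ Q) ⇛ (Q ⇛ P)) (A ∷ B ∷ []))

  ⇒-contraposeʳ : ⊢ A ⇒ ¬' B → ⊢ B ⇒ ¬' A
  ⇒-contraposeʳ {A} {B} = mp (tautology ((P ⇛ ¬ˢ Q) ⇛ (Q ⇛ ¬ˢ P)) (A ∷ B ∷ []))

  ∧-⇒-falsum : ⊢ A ∧' B ⇒ falsum → ⊢ A ⇒ ¬' B
  ∧-⇒-falsum {A} {B} = mp (tautology ((P ∧ˢ Q ⇛ ⊥ˢ) ⇛ (P ⇛ ¬ˢ Q)) (A ∷ B ∷ []))

  ⇒-⋀ : All (λ X → ⊢ A ⇒ X) As → ⊢ A ⇒ ⋀ As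
  ⇒-⋀ {A} []                   = tautology (P ⇛ ⊤ˢ) (A ∷ [])
  ⇒-⋀ {A} {X ∷ As} (⊢A⇒X ∷ hs) =
    mp₂ (tautology ((P ⇛ Q) ⇛ (P ⇛ R) ⇛ (P ⇛ Q ∧ˢ R)) (A ∷ X ∷ ⋀ As ∷ [])) ⊢A⇒X (⇒-⋀ hs)

  ⊩-singleton : (_≡ A) ⊩ C → ⊢ A ⇒ C
  ⊩-singleton (As , eqs , ⊢⋀As⇒C) = ⇒-trans (⇒-⋀ (All.map (λ { refl → ⇒-refl }) eqs)) ⊢⋀As⇒C

  All-∪-split : (Γ Δ : FSet) → All (Γ ∪ Δ) As →
                ∃₂ λ G D → All Γ G × All Δ D × (⊢ ⋀ G ∧' ⋀ D ⇒ ⋀ As)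
  All-∪-split Γ Δ [] = [] , [] , [] , [] , ⇒-⋀ []
  All-∪-split {X ∷ As} Γ Δ (inj₁ γ ∷ γδs) =
    let G , D , γs , δs , ⊢G∧D⇒As = All-∪-split Γ Δ γδs
    in  X ∷ G , D , γ ∷ γs , δs
      , mp (tautology ((P ∧ˢ Q ⇛ R) ⇛ ((S ∧ˢ P) ∧ˢ Q ⇛ S ∧ˢ R)) (⋀ G ∷ ⋀ D ∷ ⋀ As ∷ X ∷ []))
           ⊢G∧D⇒As
  All-∪-split {X ∷ As} Γ Δ (inj₂ δ ∷ γδs) =
    let G , D , γs , δs , ⊢G∧D⇒As = All-∪-split Γ Δ γδs
    in  G , X ∷ D , γs , δ ∷ δs
      , mp (tautology ((P ∧ˢ Q ⇛ R) ⇛ (P ∧ˢ (S ∧ˢ Q) ⇛ S ∧ˢ R)) (⋀ G ∷ ⋀ D ∷ ⋀ As ∷ X ∷ []))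
           ⊢G∧D⇒As

  VarIn-¬' : VarIn p (¬' A) → VarIn p A
  VarIn-¬' (impl q) = q

  AgIn-¬' : AgIn i (¬' A) → AgIn i A
  AgIn-¬' (impl q) = q

  VarIn-⋀ : VarIn p (⋀ As) → Any (VarIn p) As
  VarIn-⋀ {As = []}    (impl ())
  VarIn-⋀ {As = []}    (impr ())
  VarIn-⋀ {As = _ ∷ _} (impl (impl q))        = here q
  VarIn-⋀ {As = _ ∷ _} (impl (impr (impl q))) = there (VarIn-⋀ q)

  AgIn-⋀ : AgIn i (⋀ As) → Any (AgIn i) As
  AgIn-⋀ {As = []}    (impl ())
  AgIn-⋀ {As = []}    (impr ())
  AgIn-⋀ {As = _ ∷ _} (impl (impl q))        = here q
  AgIn-⋀ {As = _ ∷ _} (impl (impr (impl q))) = there (AgIn-⋀ q)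

  VarsOf-⋀ : {Γ : FSet} → All Γ As → VarIn p (⋀ As) → VarsOf Γ p
  VarsOf-⋀ γs q = let occ = VarIn-⋀ q in Any.lookup occ , lookupAny γs occ

  AgsOf-⋀ : {Γ : FSet} → All Γ As → AgIn i (⋀ As) → AgsOf Γ i
  AgsOf-⋀ γs q = let occ = AgIn-⋀ q in Any.lookup occ , lookupAny γs occ

  VarsOf-singleton : VarsOf (_≡ A) p → VarIn p A
  VarsOf-singleton (_ , refl , q) = q

  AgsOf-singleton : AgsOf (_≡ A) i → AgIn i A
  AgsOf-singleton (_ , refl , q) = q

RRCP⇒RCIP : ExcludedMiddle 0ℓ → ∀ {n} → RRCP n → RCIP n
RRCP⇒RCIP em rrcp V A B ⊢A⇒B disjoint = em⇒dne em λ noInterpolant →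
  rrcp V (_≡ A) (_≡ ¬' B)
    ( agentsDisjoint
    , λ (C , (vars , ags) , ⊩C , ⊩¬C) → noInterpolant
        ( C
        , ( (λ p q → let a , b = vars p q in VarsOf-singleton a , VarIn-¬' (VarsOf-singleton b))
          , (λ i q → Sum.map AgsOf-singleton (AgIn-¬' ∘ AgsOf-singleton) (ags i q)) )
        , ⊩-singleton ⊩C , ⇒-contraposeˡ (⊩-singleton ⊩¬C) ) )
    inconsistent
  where
  agentsDisjoint : ∀ i → ¬ (AgsOf (_≡ A) i × AgsOf (_≡ ¬' B) i)
  agentsDisjoint i (a , b) = disjoint i (AgsOf-singleton a , AgIn-¬' (AgsOf-singleton b))

  inconsistent : ((_≡ A) ∪ (_≡ ¬' B)) ⊩ falsum
  inconsistent = A ∷ ¬' B ∷ [] , inj₁ refl ∷ inj₂ refl ∷ []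
               , mp (tautology ((P ⇛ Q) ⇛ (P ∧ˢ (¬ˢ Q ∧ˢ ⊤ˢ) ⇛ ⊥ˢ)) (A ∷ B ∷ [])) ⊢A⇒B

RCIP⇒RRCP : ∀ {n} → RCIP n → RRCP n
RCIP⇒RRCP rcip V Γ Δ (disjoint , inseparable) (As , γδs , ⊢As⇒⊥) =
  let G , D , γs , δs , ⊢G∧D⇒As = All-∪-split Γ Δ γδs
      C , (vars , ags) , ⊢G⇒C , ⊢C⇒¬D =
        rcip V (⋀ G) (¬' ⋀ D) (∧-⇒-falsum (⇒-trans ⊢G∧D⇒As ⊢As⇒⊥))
             (λ i (a , b) → disjoint i (AgsOf-⋀ γs a , AgsOf-⋀ δs (AgIn-¬' b)))
  in  inseparable
        ( C
        , ( (λ p q → let a , b = vars p q in VarsOf-⋀ γs a , VarsOf-⋀ δs (VarIn-¬' b))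
          , (λ i q → Sum.map (AgsOf-⋀ γs) (AgsOf-⋀ δs ∘ AgIn-¬') (ags i q)) )
        , (G , γs , ⊢G⇒C) , (D , δs , ⇒-contraposeʳ ⊢C⇒¬D) )

theorem3 : ExcludedMiddle 0ℓ → (n : ℕ) → 1 ≤ n → (RRCP n → RCIP n) × (RCIP n → RRCP n)
theorem3 em n _ = RRCP⇒RCIP em , RCIP⇒RRCP
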